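{- Let $G$ be a finite, simple, connected graph of order $n=n(G)\geq 3$ with ${\rm diam}(G)=2$ which is not self-centered. If (i) $n'(G)\geq 3$, or (ii) $n'(G)=2$ and ${\rm avd}(G')>0$, or (iii) $n'(G)=1$ and ${\rm avd}(G')>1+\frac{1}{2(n-1)}$, then $E_1(G)<E_2(G)$. Otherwise, $E_1(G)>E_2(G)$.
   Context: For a connected graph $G$ and $v\in V(G)$, $\varepsilon_G(v)=\max_{u} d_G(v,u)$ is the eccentricity; ${\rm diam}(G)=\max_v\varepsilon_G(v)$, ${\rm rad}(G)=\min_v\varepsilon_G(v)$; $G$ is self-centered if ${\rm diam}(G)={\rm rad}(G)$. $E_1(G)=\sum_{v}\varepsilon_G(v)^2$, $E_2(G)=\sum_{uv\in E(G)}\varepsilon_G(u)\varepsilon_G(v)$. A vertex is universal if its degree is $n(G)-1$; $n'(G)$ is the number of universal vertices of $G$, and $G'$ is the subgraph of $G$ induced by the non-universal vertices. For a graph $X$, ${\rm avd}(X)=2m(X)/n(X)$ is its average degree, where $m(X)$ is the number of edges and $n(X)$ the number of vertices. -}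

module Defs where

open import Data.Nat using (ℕ; zero; suc; _*_; _∸_; _⊔_; _⊓_; _<_)
open import Data.Fin using (Fin; toℕ)
open import Data.Fin.Properties using (_≟_)
open import Data.Bool using (Bool; true; false; _∧_; _∨_; not; if_then_else_)
open import Data.List using (List; allFin; map; foldr; filter; length; concatMap)
open import Data.Product using (Σ; _×_; _,_)
import Data.Nat
open import Data.Bool.ListAction using (any)
open import Data.Nat.ListAction using (sum)
import Data.Bool
open import Relation.Binary.PropositionalEquality using (_≡_)
open import Relation.Nullary.Decidable using (⌊_⌋)
open import Data.Integer using (+_)
open import Data.Rational using (ℚ; _/_; 0ℚ; 1ℚ; _+_)

-- average degree 2m/n of a graph with m edges and n vertices (0 for the empty graph)
avdOf : ℕ → ℕ → ℚ
avdOf m zero    = 0ℚ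
avdOf m (suc k) = + (2 * m) / suc k

-- the threshold 1 + 1/(2(n-1)) from case (iii); only used for n ≥ 3
-- (for n ≤ 1 the expression is undefined; we set it to 1 there, never used)
threshold : ℕ → ℚ
threshold zero          = 1ℚ
threshold (suc zero)    = 1ℚ
threshold (suc (suc k)) = 1ℚ + (+ 1 / (2 * suc k))

record Graph (n : ℕ) : Set where
  field
    adj    : Fin n → Fin n → Bool
    sym    : ∀ u v → adj u v ≡ adj v u
    irrefl : ∀ v → adj v v ≡ false
open Graph public

module _ {n : ℕ} (G : Graph n) where

  within : ℕ → Fin n → Fin n → Bool
  within zero    u v = ⌊ u ≟ v ⌋
  within (suc k) u v = within k u v ∨ any (λ w → adj G u w ∧ within k w v) (allFin n)

  Connected : Set
  Connected = ∀ u v → Σ ℕ (λ k → within k u v ≡ true)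

  private
    least : ℕ → (ℕ → Bool) → ℕ
    least zero       p = zero
    least (suc fuel) p = if p zero then zero else suc (least fuel (λ k → p (suc k)))

  -- distance d_G(u,v) (in a connected graph the distance is at most n-1)
  dist : Fin n → Fin n → ℕ
  dist u v = least n (λ k → within k u v)

  maxL : List ℕ → ℕ
  maxL = foldr _⊔_ 0

  ecc : Fin n → ℕ
  ecc v = maxL (map (dist v) (allFin n))

  diam : ℕ
  diam = maxL (map ecc (allFin n))

  rad : ℕ
  rad = foldr _⊓_ diam (map ecc (allFin n))

  SelfCentered : Set
  SelfCentered = diam ≡ rad

  edges : List (Fin n × Fin n)
  edges = concatMap (λ u → map (λ v → (u , v))
            (filter (λ v → toℕ u Data.Nat.<? toℕ v) (filter (λ v → adj G u v Data.Bool.≟ true) (allFin n))))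
            (allFin n)

  E₁ : ℕ
  E₁ = sum (map (λ v → ecc v * ecc v) (allFin n))

  E₂ : ℕ
  E₂ = sum (map (λ { (u , v) → ecc u * ecc v }) edges)

  degree : Fin n → ℕ
  degree v = length (filter (λ u → adj G v u Data.Bool.≟ true) (allFin n))

  isUniversal : Fin n → Bool
  isUniversal v = ⌊ degree v Data.Nat.≟ (n ∸ 1) ⌋

  n′ : ℕ
  n′ = length (filter (λ v → isUniversal v Data.Bool.≟ true) (allFin n))

  -- G' = subgraph induced by non-universal vertices: its order and size
  nG′ : ℕ
  nG′ = length (filter (λ v → isUniversal v Data.Bool.≟ false) (allFin n))

  mG′ : ℕ
  mG′ = length (filter (λ { (u , v) → (not (isUniversal u) ∧ not (isUniversal v)) Data.Bool.≟ true }) edges)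

  -- avd(G') = 2 m(G') / n(G')  (G' empty: value 0 by convention; never used in the theorem)
  avdG′ : ℚ
  avdG′ = avdOf mG′ nG′

module Submission where

-- In a graph of diameter two the universal vertices are exactly those of eccentricity 1 and all
-- others have eccentricity 2.  With k universal vertices, w = n − k others and e edges among the
-- latter, E₁ = k + 4w and, sorting the edges by the kind of their ends, 2E₂ = k(k − 1) + 4kw + 8e.
-- Hence 2(E₂ − E₁) = k(k − 3) + 4w(k − 2) + 8e, where k ≥ 1 because G is not self-centered and
-- w ≥ 1 because its diameter is 2.  For k ≥ 3 this is positive, for k = 2 it is 8e − 2, and for
-- k = 1 it is 8e − 4w − 2, which vanishes for no e by parity; the average-degree conditions of the
-- theorem are exactly these sign conditions.

open import Defs
open import Data.Nat using (ℕ; _≥_; _<_; _>_; _∸_; _*_)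
open import Data.Product using (_×_)
open import Data.Sum using (_⊎_)
open import Relation.Nullary using (¬_)
open import Relation.Binary.PropositionalEquality using (_≡_)
open import Data.Rational using (ℚ; 0ℚ)
import Data.Rational

open import Data.Bool using (Bool; true; false; not; _∧_; _∨_; if_then_else_)
import Data.Bool as Bool
open import Data.Bool.ListAction using (any)
open import Data.Bool.Properties
  using (∨-zeroʳ; ∧-zeroʳ; ∧-comm; T-≡; if-float; if-eta; if-cong; if-cong-then; not-injective)
open import Data.Fin using (Fin; zero; suc; toℕ; punchIn)
open import Data.Fin.Properties using (_≟_; punchInᵢ≢i; toℕ-injective)
open import Data.Integer as ℤ using (+<+)
open import Data.Integer.Properties using (pos-*; drop‿+<+)
open import Data.List using (List; []; _∷_; _++_; allFin; map; filter; length; concatMap; tabulate; foldr)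
open import Data.List.Properties using (map-++; map-∘)
import Data.Nat as ℕ
open import Data.Nat using (zero; suc; _+_; _≤_; _⊔_; _⊓_; z≤n; s≤s; z<s; s≤s⁻¹; >-nonZero)
open import Data.Nat.ListAction using (sum)
open import Data.Nat.ListAction.Properties using (sum-++)
open import Data.Nat.Properties hiding (_≟_)
open import Data.Nat.Tactic.RingSolver using (solve-∀)
open import Data.Product using (_,_; proj₁; proj₂; curry)
open import Data.Sum using (inj₁; inj₂)
open import Data.Rational as ℚ using (1ℚ; fromℚᵘ; toℚᵘ)
open import Data.Rational.Properties
  using (toℚᵘ-fromℚᵘ; toℚᵘ-injective; toℚᵘ-homo-+; toℚᵘ-mono-<; toℚᵘ-cancel-<)
open import Data.Rational.Unnormalised as ℚᵘ using (mkℚᵘ; 1ℚᵘ; *<*; *≡*)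
open import Data.Rational.Unnormalised.Properties
  using (≃-sym; +-cong; <-respˡ-≃; <-respʳ-≃; drop-*<*; module ≃-Reasoning)
open import Function using (_∘_; id; _⇔_; mk⇔; Equivalence)
open import Function.Construct.Composition using (_⇔-∘_)
open import Relation.Binary using (tri<; tri≈; tri>)
open import Relation.Binary.PropositionalEquality as ≡
  using (_≢_; refl; trans; cong; cong₂; subst; subst₂; module ≡-Reasoning)
open import Relation.Nullary using (Dec; yes; no; does; contradiction)
open import Relation.Nullary.Decidable using (⌊_⌋; toWitness; isYes≗does; dec-true; dec-false)
open import Algebra.Properties.Semiring.Sum +-*-semiring
  using (sum-syntax; ∑-distrib-+; ∑-comm; sum-cong-≗; sum-replicate-zero; *-distribˡ-sum)

if-true : ∀ {A : Set} {b} {x y : A} → b ≡ true → (if b then x else y) ≡ x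
if-true refl = refl

if-false : ∀ {A : Set} {b} {x y : A} → b ≡ false → (if b then x else y) ≡ y
if-false refl = refl

⌊⌋-true : ∀ {A : Set} (a? : Dec A) → A → ⌊ a? ⌋ ≡ true
⌊⌋-true a? a = trans (isYes≗does a?) (dec-true a? a)

⌊⌋-false : ∀ {A : Set} (a? : Dec A) → ¬ A → ⌊ a? ⌋ ≡ false
⌊⌋-false a? ¬a = trans (isYes≗does a?) (dec-false a? ¬a)

does-≟-true : ∀ b → does (b Bool.≟ true) ≡ b
does-≟-true true  = refl
does-≟-true false = refl

does-≟-false : ∀ b → does (b Bool.≟ false) ≡ not b
does-≟-false true  = refl
does-≟-false false = refl

⌊⌋≡true⇒ : ∀ {A : Set} (a? : Dec A) → ⌊ a? ⌋ ≡ true → A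
⌊⌋≡true⇒ a? eq = toWitness (Equivalence.from T-≡ eq)

indicator : Bool → ℕ
indicator b = if b then 1 else 0

count : ∀ {n} → (Fin n → Bool) → ℕ
count {n} b = ∑[ i < n ] indicator (b i)

∑-ones : ∀ n → ∑[ i < n ] 1 ≡ n
∑-ones zero    = refl
∑-ones (suc n) = cong suc (∑-ones n)

count+count-not : ∀ {n} (b : Fin n → Bool) → count b + count (not ∘ b) ≡ n
count+count-not {n} b = begin
  count b + count (not ∘ b)                             ≡⟨ ∑-distrib-+ (indicator ∘ b) (indicator ∘ not ∘ b) ⟨
  ∑[ i < n ] (indicator (b i) + indicator (not (b i)))  ≡⟨ sum-cong-≗ (one ∘ b) ⟩
  ∑[ i < n ] 1                                          ≡⟨ ∑-ones n ⟩
  n                                                     ∎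
  where
  open ≡-Reasoning
  one : ∀ x → indicator x + indicator (not x) ≡ 1
  one true  = refl
  one false = refl

count-cong : ∀ {n} {b c : Fin n → Bool} → (∀ i → b i ≡ c i) → count b ≡ count c
count-cong b≡c = sum-cong-≗ (cong indicator ∘ b≡c)

∑-if : ∀ {n} (b : Fin n → Bool) x y → ∑[ i < n ] (if b i then x else y) ≡ x * count b + y * count (not ∘ b)
∑-if {n} b x y = begin
  ∑[ i < n ] (if b i then x else y)
    ≡⟨ sum-cong-≗ (split ∘ b) ⟩
  ∑[ i < n ] (x * indicator (b i) + y * indicator (not (b i)))
    ≡⟨ ∑-distrib-+ (λ i → x * indicator (b i)) (λ i → y * indicator (not (b i))) ⟩
  ∑[ i < n ] (x * indicator (b i)) + ∑[ i < n ] (y * indicator (not (b i)))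
    ≡⟨ cong₂ _+_ (*-distribˡ-sum x (indicator ∘ b)) (*-distribˡ-sum y (indicator ∘ not ∘ b)) ⟨
  x * count b + y * count (not ∘ b)
    ∎
  where
  open ≡-Reasoning
  split : ∀ c → (if c then x else y) ≡ x * indicator c + y * indicator (not c)
  split true  = ≡.sym (trans (cong₂ _+_ (*-identityʳ x) (*-zeroʳ y)) (+-identityʳ x))
  split false = ≡.sym (trans (cong (_+ y * 1) (*-zeroʳ x)) (*-identityʳ y))

count≡0⇒false : ∀ {n} (b : Fin n → Bool) → count b ≡ 0 → ∀ i → b i ≡ false
count≡0⇒false b eq zero with b zero
... | false = refl
count≡0⇒false b eq (suc i) = count≡0⇒false (b ∘ suc) (m+n≡0⇒n≡0 (indicator (b zero)) eq) i

∑-zero : ∀ {n} (f : Fin n → ℕ) → (∀ i → f i ≡ 0) → ∑[ i < n ] f i ≡ 0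
∑-zero {n} f f≡0 = trans (sum-cong-≗ f≡0) (sum-replicate-zero n)

∑-select : ∀ {n} (u : Fin n) (g : Fin n → ℕ) → ∑[ i < n ] (if does (i ≟ u) then g i else 0) ≡ g u
∑-select {suc n} zero    g = trans (cong (g zero +_) (sum-replicate-zero n)) (+-identityʳ (g zero))
∑-select {suc n} (suc u) g = ∑-select u (g ∘ suc)

∑-mono-≤ : ∀ {n} {f g : Fin n → ℕ} → (∀ i → f i ≤ g i) → ∑[ i < n ] f i ≤ ∑[ i < n ] g i
∑-mono-≤ {zero}  f≤g = z≤n
∑-mono-≤ {suc n} f≤g = +-mono-≤ (f≤g zero) (∑-mono-≤ (f≤g ∘ suc))

sum-map-tabulate : ∀ {A : Set} {n} (f : Fin n → A) (g : A → ℕ) → sum (map g (tabulate f)) ≡ ∑[ i < n ] g (f i)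
sum-map-tabulate {n = zero}  f g = refl
sum-map-tabulate {n = suc n} f g = cong (g (f zero) +_) (sum-map-tabulate (f ∘ suc) g)

sum-map-filter : ∀ {A : Set} {P : A → Set} (P? : ∀ x → Dec (P x)) (g : A → ℕ) xs →
                 sum (map g (filter P? xs)) ≡ sum (map (λ x → if does (P? x) then g x else 0) xs)
sum-map-filter P? g []       = refl
sum-map-filter P? g (x ∷ xs) with does (P? x)
... | true  = cong (g x +_) (sum-map-filter P? g xs)
... | false = sum-map-filter P? g xs

length-filter≡sum : ∀ {A : Set} {P : A → Set} (P? : ∀ x → Dec (P x)) xs →
                    length (filter P? xs) ≡ sum (map (indicator ∘ does ∘ P?) xs)
length-filter≡sum P? []       = refl
length-filter≡sum P? (x ∷ xs) with does (P? x)
... | true  = cong suc (length-filter≡sum P? xs)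
... | false = length-filter≡sum P? xs

sum-map-concatMap : ∀ {A B : Set} (F : A → List B) (g : B → ℕ) xs →
                    sum (map g (concatMap F xs)) ≡ sum (map (sum ∘ map g ∘ F) xs)
sum-map-concatMap F g []       = refl
sum-map-concatMap F g (x ∷ xs) = begin
  sum (map g (F x ++ concatMap F xs))       ≡⟨ cong sum (map-++ g (F x) (concatMap F xs)) ⟩
  sum (map g (F x) ++ map g (concatMap F xs)) ≡⟨ sum-++ (map g (F x)) (map g (concatMap F xs)) ⟩
  sum (map g (F x)) + sum (map g (concatMap F xs))      ≡⟨ cong (sum (map g (F x)) +_) (sum-map-concatMap F g xs) ⟩
  sum (map g (F x)) + sum (map (sum ∘ map g ∘ F) xs)    ∎
  where open ≡-Reasoning

length-filter-allFin : ∀ {n} {P : Fin n → Set} (P? : ∀ i → Dec (P i)) →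
                       length (filter P? (allFin n)) ≡ count (does ∘ P?)
length-filter-allFin {n} P? = trans (length-filter≡sum P? (allFin n)) (sum-map-tabulate id (indicator ∘ does ∘ P?))

≤-foldr-⊔-map-tabulate : ∀ {A : Set} {n} (f : Fin n → A) (h : A → ℕ) i →
                         h (f i) ≤ foldr _⊔_ 0 (map h (tabulate f))
≤-foldr-⊔-map-tabulate f h zero    = m≤m⊔n (h (f zero)) _
≤-foldr-⊔-map-tabulate f h (suc i) = ≤-trans (≤-foldr-⊔-map-tabulate (f ∘ suc) h i) (m≤n⊔m (h (f zero)) _)

foldr-⊔-map-tabulate-lub : ∀ {A : Set} {n} (f : Fin n → A) (h : A → ℕ) {b} →
                           (∀ i → h (f i) ≤ b) → foldr _⊔_ 0 (map h (tabulate f)) ≤ b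
foldr-⊔-map-tabulate-lub {n = zero}  f h h≤b = z≤n
foldr-⊔-map-tabulate-lub {n = suc n} f h h≤b =
  ⊔-lub (h≤b zero) (foldr-⊔-map-tabulate-lub (f ∘ suc) h (h≤b ∘ suc))

foldr-⊓-map-tabulate-const : ∀ {A : Set} {n} (f : Fin n → A) (h : A → ℕ) {d} →
                             (∀ i → h (f i) ≡ d) → foldr _⊓_ d (map h (tabulate f)) ≡ d
foldr-⊓-map-tabulate-const {n = zero}  f h h≡d = refl
foldr-⊓-map-tabulate-const {n = suc n} f h {d} h≡d =
  trans (cong₂ _⊓_ (h≡d zero) (foldr-⊓-map-tabulate-const (f ∘ suc) h (h≡d ∘ suc))) (⊓-idem d)

any-tabulate-true : ∀ {A : Set} {n} (f : Fin n → A) (p : A → Bool) i →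
                    p (f i) ≡ true → any p (tabulate f) ≡ true
any-tabulate-true f p zero    pfi = cong (_∨ any p (tabulate (f ∘ suc))) pfi
any-tabulate-true f p (suc i) pfi =
  trans (cong (p (f zero) ∨_) (any-tabulate-true (f ∘ suc) p i pfi)) (∨-zeroʳ (p (f zero)))

any-tabulate-false : ∀ {A : Set} {n} (f : Fin n → A) (p : A → Bool) →
                     (∀ i → p (f i) ≡ false) → any p (tabulate f) ≡ false
any-tabulate-false {n = zero}  f p pf = refl
any-tabulate-false {n = suc n} f p pf = cong₂ _∨_ (pf zero) (any-tabulate-false (f ∘ suc) p (pf ∘ suc))

-- Distances and universal vertices

-- dist is a search for the least k with a walk of length at most k, with fuel the number of
-- vertices; with at least two vertices its first two steps, the distances 0 and 1, unfold.
module _ {m : ℕ} (G : Graph (2 + m)) where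

  adj⇒≢ : ∀ {u v} → adj G u v ≡ true → u ≢ v
  adj⇒≢ {u} uv refl = contradiction (trans (≡.sym uv) (irrefl G u)) λ ()

  within-1-adj : ∀ {u v} → adj G u v ≡ true → within G 1 u v ≡ true
  within-1-adj {u} {v} uv =
    trans (cong (within G 0 u v ∨_) (any-tabulate-true id (λ x → adj G u x ∧ within G 0 x v) v via-v))
          (∨-zeroʳ (within G 0 u v))
    where
    via-v : adj G u v ∧ ⌊ v ≟ v ⌋ ≡ true
    via-v = cong₂ _∧_ uv (⌊⌋-true (v ≟ v) refl)

  within-1-nonadj : ∀ {u v} → u ≢ v → adj G u v ≡ false → within G 1 u v ≡ false
  within-1-nonadj {u} {v} u≢v uv =
    cong₂ _∨_ (⌊⌋-false (u ≟ v) u≢v) (any-tabulate-false id (λ x → adj G u x ∧ within G 0 x v) no-step)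
    where
    no-step : ∀ x → adj G u x ∧ ⌊ x ≟ v ⌋ ≡ false
    no-step x with x ≟ v
    ... | yes refl = cong (_∧ true) uv
    ... | no _     = ∧-zeroʳ (adj G u x)

  dist-self : ∀ v → dist G v v ≡ 0
  dist-self v = if-true (⌊⌋-true (v ≟ v) refl)

  dist-adj : ∀ {u v} → adj G u v ≡ true → dist G u v ≡ 1
  dist-adj {u} {v} uv = trans (if-false (⌊⌋-false (u ≟ v) (adj⇒≢ uv))) (cong suc (if-true (within-1-adj uv)))

  dist-≢ : ∀ {u v} → u ≢ v → 1 ≤ dist G u v
  dist-≢ {u} {v} u≢v = subst (1 ≤_) (≡.sym (if-false (⌊⌋-false (u ≟ v) u≢v))) (s≤s z≤n)

  dist-nonadj : ∀ {u v} → u ≢ v → adj G u v ≡ false → 2 ≤ dist G u v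
  dist-nonadj {u} {v} u≢v uv =
    subst (2 ≤_)
      (≡.sym (trans (if-false (⌊⌋-false (u ≟ v) u≢v)) (cong suc (if-false (within-1-nonadj u≢v uv)))))
      (s≤s (s≤s z≤n))

  dist≤ecc : ∀ u v → dist G u v ≤ ecc G u
  dist≤ecc u = ≤-foldr-⊔-map-tabulate id (dist G u)

  ecc≥1 : ∀ v → 1 ≤ ecc G v
  ecc≥1 v = ≤-trans (dist-≢ (punchInᵢ≢i v zero ∘ ≡.sym)) (dist≤ecc v (punchIn v zero))

  ecc≤diam : ∀ v → ecc G v ≤ diam G
  ecc≤diam = ≤-foldr-⊔-map-tabulate id (ecc G)

  Dominating : Fin (2 + m) → Set
  Dominating v = ∀ u → u ≢ v → adj G v u ≡ true

  dominating⇒ecc≤1 : ∀ {v} → Dominating v → ecc G v ≤ 1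
  dominating⇒ecc≤1 {v} dom = foldr-⊔-map-tabulate-lub id (dist G v) dist≤1
    where
    dist≤1 : ∀ u → dist G v u ≤ 1
    dist≤1 u with u ≟ v
    ... | yes refl = ≤-trans (≤-reflexive (dist-self u)) z≤n
    ... | no u≢v   = ≤-reflexive (dist-adj (dom u u≢v))

  ecc≤1⇒dominating : ∀ {v} → ecc G v ≤ 1 → Dominating v
  ecc≤1⇒dominating {v} ecc≤1 u u≢v with adj G v u in vu
  ... | true  = refl
  ... | false = contradiction (≤-trans (dist-nonadj (u≢v ∘ ≡.sym) vu) (≤-trans (dist≤ecc v u) ecc≤1))
                              (<-irrefl refl)

  degree≡count : ∀ v → degree G v ≡ count (adj G v)
  degree≡count v = trans (length-filter-allFin (λ u → adj G v u Bool.≟ true)) (count-cong (does-≟-true ∘ adj G v))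

  degree+non-neighbours : ∀ v → degree G v + count (not ∘ adj G v) ≡ 2 + m
  degree+non-neighbours v = trans (cong (_+ count (not ∘ adj G v)) (degree≡count v)) (count+count-not (adj G v))

  dominating⇒universal : ∀ {v} → Dominating v → isUniversal G v ≡ true
  dominating⇒universal {v} dom = ⌊⌋-true (degree G v ℕ.≟ suc m) (suc-injective (begin
    suc (degree G v)                        ≡⟨ +-comm 1 (degree G v) ⟩
    degree G v + 1                          ≡⟨ cong (degree G v +_) only-self ⟨
    degree G v + count (not ∘ adj G v)      ≡⟨ degree+non-neighbours v ⟩
    2 + m                                   ∎))
    where
    open ≡-Reasoning
    self-only : ∀ u → indicator (not (adj G v u)) ≡ (if does (u ≟ v) then 1 else 0)
    self-only u with u ≟ v
    ... | yes refl = cong (indicator ∘ not) (irrefl G u)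
    ... | no u≢v   = cong (indicator ∘ not) (dom u u≢v)
    only-self : count (not ∘ adj G v) ≡ 1
    only-self = trans (sum-cong-≗ self-only) (∑-select v (λ _ → 1))

  universal⇒dominating : ∀ {v} → isUniversal G v ≡ true → Dominating v
  universal⇒dominating {v} univ u u≢v with adj G v u in vu
  ... | true  = refl
  ... | false = contradiction (≤-trans two-non-neighbours (≤-reflexive one-non-neighbour)) (<-irrefl refl)
    where
    one-non-neighbour : count (not ∘ adj G v) ≡ 1
    one-non-neighbour = +-cancelˡ-≡ (suc m) _ _
      (trans (cong (_+ count (not ∘ adj G v)) (≡.sym (⌊⌋≡true⇒ (degree G v ℕ.≟ suc m) univ)))
             (trans (degree+non-neighbours v) (+-comm 1 (suc m))))
    v-and-u : ∀ i → (if does (i ≟ v) then 1 else 0) + (if does (i ≟ u) then 1 else 0) ≤ indicator (not (adj G v i))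
    v-and-u i with i ≟ v | i ≟ u
    ... | yes refl | yes refl = contradiction refl u≢v
    ... | yes refl | no _     = ≤-reflexive (cong (indicator ∘ not) (≡.sym (irrefl G i)))
    ... | no _     | yes refl = ≤-reflexive (cong (indicator ∘ not) (≡.sym vu))
    ... | no _     | no _     = z≤n
    two-non-neighbours : 2 ≤ count (not ∘ adj G v)
    two-non-neighbours = ≤-trans
      (≤-reflexive (≡.sym (trans (∑-distrib-+ (λ i → if does (i ≟ v) then 1 else 0)
                                              (λ i → if does (i ≟ u) then 1 else 0))
                                (cong₂ _+_ (∑-select v (λ _ → 1)) (∑-select u (λ _ → 1))))))
      (∑-mono-≤ v-and-u)

  dominating-row : ∀ {v} → Dominating v → (g : Fin (2 + m) → ℕ) →
                   ∑[ u < 2 + m ] (if adj G v u then g u else 0) + g v ≡ ∑[ u < 2 + m ] g u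
  dominating-row {v} dom g = begin
    ∑[ u < 2 + m ] (if adj G v u then g u else 0) + g v
      ≡⟨ cong (∑[ u < 2 + m ] (if adj G v u then g u else 0) +_) (∑-select v g) ⟨
    ∑[ u < 2 + m ] (if adj G v u then g u else 0) + ∑[ u < 2 + m ] (if does (u ≟ v) then g u else 0)
      ≡⟨ ∑-distrib-+ (λ u → if adj G v u then g u else 0) (λ u → if does (u ≟ v) then g u else 0) ⟨
    ∑[ u < 2 + m ] ((if adj G v u then g u else 0) + (if does (u ≟ v) then g u else 0))
      ≡⟨ sum-cong-≗ neighbour-or-self ⟩
    ∑[ u < 2 + m ] g u
      ∎
    where
    open ≡-Reasoning
    neighbour-or-self : ∀ u → (if adj G v u then g u else 0) + (if does (u ≟ v) then g u else 0) ≡ g u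
    neighbour-or-self u with u ≟ v
    ... | yes refl rewrite irrefl G u = refl
    ... | no u≢v   rewrite dom u u≢v = +-identityʳ (g u)

  adjacent-to-universal : ∀ {u v} → isUniversal G v ≡ true → isUniversal G u ≡ false → adj G u v ≡ true
  adjacent-to-universal {u} {v} univ-v univ-u =
    trans (Graph.sym G u v)
          (universal⇒dominating univ-v u λ { refl → contradiction (trans (≡.sym univ-v) univ-u) λ () })

-- Sums over the arcs of a graph

module _ {n : ℕ} (G : Graph n) where

  arcSum : (Fin n → Fin n → ℕ) → ℕ
  arcSum g = ∑[ u < n ] ∑[ v < n ] (if adj G u v then g u v else 0)

  arcSum-cong : ∀ {g h} → (∀ u v → g u v ≡ h u v) → arcSum g ≡ arcSum h
  arcSum-cong g≡h = sum-cong-≗ λ u → sum-cong-≗ λ v → if-cong-then (adj G u v) (g≡h u v)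

  arcSum-+ : ∀ g h → arcSum (λ u v → g u v + h u v) ≡ arcSum g + arcSum h
  arcSum-+ g h = trans (sum-cong-≗ row) (∑-distrib-+ (λ u → ∑[ v < n ] (if adj G u v then g u v else 0))
                                                      (λ u → ∑[ v < n ] (if adj G u v then h u v else 0)))
    where
    split : ∀ b x y → (if b then x + y else 0) ≡ (if b then x else 0) + (if b then y else 0)
    split true  x y = refl
    split false x y = refl
    row : ∀ u → ∑[ v < n ] (if adj G u v then g u v + h u v else 0)
              ≡ ∑[ v < n ] (if adj G u v then g u v else 0) + ∑[ v < n ] (if adj G u v then h u v else 0)
    row u = trans (sum-cong-≗ λ v → split (adj G u v) (g u v) (h u v))
                  (∑-distrib-+ (λ v → if adj G u v then g u v else 0) (λ v → if adj G u v then h u v else 0))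

  arcSum-* : ∀ c g → arcSum (λ u v → c * g u v) ≡ c * arcSum g
  arcSum-* c g =
    trans (sum-cong-≗ row) (≡.sym (*-distribˡ-sum c (λ u → ∑[ v < n ] (if adj G u v then g u v else 0))))
    where
    scale : ∀ b x → (if b then c * x else 0) ≡ c * (if b then x else 0)
    scale true  x = refl
    scale false x = ≡.sym (*-zeroʳ c)
    row : ∀ u → ∑[ v < n ] (if adj G u v then c * g u v else 0) ≡ c * ∑[ v < n ] (if adj G u v then g u v else 0)
    row u = trans (sum-cong-≗ λ v → scale (adj G u v) (g u v))
                  (≡.sym (*-distribˡ-sum c (λ v → if adj G u v then g u v else 0)))

  upper : (Fin n → Fin n → ℕ) → Fin n → Fin n → ℕ
  upper g u v = if does (toℕ u ℕ.<? toℕ v) then g u v else 0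

  sum-edges : ∀ h → sum (map h (edges G)) ≡ arcSum (upper (curry h))
  sum-edges h =
    trans (sum-map-concatMap F h (allFin n)) (trans (sum-map-tabulate id (sum ∘ map h ∘ F)) (sum-cong-≗ row))
    where
    Q = λ u v → adj G u v Bool.≟ true
    P = λ u v → toℕ u ℕ.<? toℕ v
    F : Fin n → List (Fin n × Fin n)
    F u = map (u ,_) (filter (P u) (filter (Q u) (allFin n)))
    row : ∀ u → sum (map h (F u)) ≡ ∑[ v < n ] (if adj G u v then upper (curry h) u v else 0)
    row u = begin
      sum (map h (F u))
        ≡⟨ cong sum (map-∘ (filter (P u) (filter (Q u) (allFin n)))) ⟨
      sum (map (h ∘ (u ,_)) (filter (P u) (filter (Q u) (allFin n))))
        ≡⟨ sum-map-filter (P u) (h ∘ (u ,_)) (filter (Q u) (allFin n)) ⟩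
      sum (map (upper (curry h) u) (filter (Q u) (allFin n)))
        ≡⟨ sum-map-filter (Q u) (upper (curry h) u) (allFin n) ⟩
      sum (map (λ v → if does (Q u v) then upper (curry h) u v else 0) (allFin n))
        ≡⟨ sum-map-tabulate id (λ v → if does (Q u v) then upper (curry h) u v else 0) ⟩
      ∑[ v < n ] (if does (Q u v) then upper (curry h) u v else 0)
        ≡⟨ sum-cong-≗ (λ v → if-cong (does-≟-true (adj G u v))) ⟩
      ∑[ v < n ] (if adj G u v then upper (curry h) u v else 0)
        ∎
      where open ≡-Reasoning

  arcSum-symmetric : ∀ g → (∀ u v → g u v ≡ g v u) → arcSum g ≡ arcSum (upper g) + arcSum (upper g)
  arcSum-symmetric g g-sym = begin
    arcSum g
      ≡⟨ sum-cong-≗ (λ u → trans (sum-cong-≗ (split u)) (∑-distrib-+ (A u) (λ v → A v u))) ⟩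
    ∑[ u < n ] (∑[ v < n ] A u v + ∑[ v < n ] A v u)
      ≡⟨ ∑-distrib-+ (λ u → ∑[ v < n ] A u v) (λ u → ∑[ v < n ] A v u) ⟩
    arcSum (upper g) + ∑[ u < n ] ∑[ v < n ] A v u
      ≡⟨ cong (arcSum (upper g) +_) (∑-comm (λ u v → A v u)) ⟩
    arcSum (upper g) + arcSum (upper g)
      ∎
    where
    open ≡-Reasoning
    A : Fin n → Fin n → ℕ
    A u v = if adj G u v then upper g u v else 0
    split : ∀ u v → (if adj G u v then g u v else 0) ≡ A u v + A v u
    split u v with <-cmp (toℕ u) (toℕ v)
    ... | tri< u<v _ v≮u
      rewrite dec-true (toℕ u ℕ.<? toℕ v) u<v | dec-false (toℕ v ℕ.<? toℕ u) v≮u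
      = ≡.sym (trans (cong ((if adj G u v then g u v else 0) +_) (if-eta (adj G v u)))
                     (+-identityʳ (if adj G u v then g u v else 0)))
    ... | tri> u≮v _ v<u
      rewrite dec-false (toℕ u ℕ.<? toℕ v) u≮v | dec-true (toℕ v ℕ.<? toℕ u) v<u | Graph.sym G u v | g-sym u v
      = ≡.sym (cong (_+ (if adj G v u then g v u else 0)) (if-eta (adj G v u)))
    ... | tri≈ _ u≡v _ with toℕ-injective u≡v
    ... | refl rewrite irrefl G u = refl

  arcSum≡sum-edges+sum-edges : ∀ h → (∀ u v → h (u , v) ≡ h (v , u)) →
                               arcSum (curry h) ≡ sum (map h (edges G)) + sum (map h (edges G))
  arcSum≡sum-edges+sum-edges h h-sym =
    trans (arcSum-symmetric (curry h) h-sym) (≡.sym (cong₂ _+_ (sum-edges h) (sum-edges h)))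

-- Graphs of diameter two

module _ {m : ℕ} (G : Graph (2 + m)) (diam≡2 : diam G ≡ 2) where

  private
    universal : Fin (2 + m) → Bool
    universal = isUniversal G

  ecc-diameter-two : ∀ v → ecc G v ≡ (if universal v then 1 else 2)
  ecc-diameter-two v with universal v in univ
  ... | true  = ≤-antisym (dominating⇒ecc≤1 G (universal⇒dominating G univ)) (ecc≥1 G v)
  ... | false = ≤-antisym (subst (ecc G v ≤_) diam≡2 (ecc≤diam G v)) (≰⇒> ecc≰1)
    where
    ecc≰1 : ¬ ecc G v ≤ 1
    ecc≰1 ecc≤1 = contradiction (trans (≡.sym (dominating⇒universal G (ecc≤1⇒dominating G ecc≤1))) univ) λ ()

  n′≡count : n′ G ≡ count universal
  n′≡count =
    trans (length-filter-allFin (λ v → universal v Bool.≟ true)) (count-cong (does-≟-true ∘ universal))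

  nG′≡count : nG′ G ≡ count (not ∘ universal)
  nG′≡count =
    trans (length-filter-allFin (λ v → universal v Bool.≟ false)) (count-cong (does-≟-false ∘ universal))

  n′+nG′ : n′ G + nG′ G ≡ 2 + m
  n′+nG′ = trans (cong₂ _+_ n′≡count nG′≡count) (count+count-not universal)

  ∑-of-ecc : ∀ (f : ℕ → ℕ) → ∑[ v < 2 + m ] f (ecc G v) ≡ f 1 * n′ G + f 2 * nG′ G
  ∑-of-ecc f = trans (sum-cong-≗ (λ v → trans (cong f (ecc-diameter-two v)) (if-float f (universal v))))
                     (trans (∑-if universal (f 1) (f 2))
                            (≡.sym (cong₂ (λ k w → f 1 * k + f 2 * w) n′≡count nG′≡count)))

  E₁≡n′+4nG′ : E₁ G ≡ n′ G + 4 * nG′ G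
  E₁≡n′+4nG′ = trans (sum-map-tabulate id (λ v → ecc G v * ecc G v))
              (trans (∑-of-ecc (λ e → e * e)) (cong (_+ 4 * nG′ G) (*-identityˡ (n′ G))))

  ∑-ecc : ∑[ v < 2 + m ] ecc G v ≡ n′ G + 2 * nG′ G
  ∑-ecc = trans (∑-of-ecc id) (cong (_+ 2 * nG′ G) (*-identityˡ (n′ G)))

  E₂+E₂≡arcSum : E₂ G + E₂ G ≡ arcSum G (λ u v → ecc G u * ecc G v)
  E₂+E₂≡arcSum = ≡.sym (arcSum≡sum-edges+sum-edges G _ (λ u v → *-comm (ecc G u) (ecc G v)))

  mG′+mG′≡arcSum : mG′ G + mG′ G ≡ arcSum G (λ u v → indicator (not (universal u) ∧ not (universal v)))
  mG′+mG′≡arcSum = ≡.sym (trans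
    (arcSum-cong G (λ u v → cong indicator (≡.sym (does-≟-true (not (universal u) ∧ not (universal v))))))
    (trans (arcSum≡sum-edges+sum-edges G _
             (λ u v → cong (indicator ∘ does ∘ (Bool._≟ true)) (∧-comm (not (universal u)) _)))
           (≡.sym (cong₂ _+_ (length-filter≡sum _ (edges G)) (length-filter≡sum _ (edges G))))))

  ecc-product : ∀ u v → ecc G u * ecc G v ≡
    4 * indicator (not (universal u) ∧ not (universal v))
      + ((if universal u then ecc G v else 0) + (if not (universal u) then (if universal v then 2 else 0) else 0))
  ecc-product u v rewrite ecc-diameter-two u | ecc-diameter-two v with universal u | universal v
  ... | true  | true  = refl
  ... | true  | false = refl
  ... | false | true  = refl
  ... | false | false = refl

  -- A universal vertex is adjacent to every other vertex, so its row misses only its own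
  -- eccentricity 1; adding n′ G restores these instead of subtracting them.
  universal-rows : arcSum G (λ u v → if universal u then ecc G v else 0) + n′ G ≡ (n′ G + 2 * nG′ G) * n′ G
  universal-rows = begin
    arcSum G g + n′ G
      ≡⟨ cong (arcSum G g +_) n′≡count ⟩
    arcSum G g + count universal
      ≡⟨ ∑-distrib-+ (λ u → ∑[ v < 2 + m ] (if adj G u v then g u v else 0)) (indicator ∘ universal) ⟨
    ∑[ u < 2 + m ] (∑[ v < 2 + m ] (if adj G u v then g u v else 0) + indicator (universal u))
      ≡⟨ sum-cong-≗ row ⟩
    ∑[ u < 2 + m ] (if universal u then ∑[ v < 2 + m ] ecc G v else 0)
      ≡⟨ ∑-if universal (∑[ v < 2 + m ] ecc G v) 0 ⟩
    ∑[ v < 2 + m ] ecc G v * count universal + 0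
      ≡⟨ cong₂ (λ s k → s * k + 0) ∑-ecc (≡.sym n′≡count) ⟩
    (n′ G + 2 * nG′ G) * n′ G + 0
      ≡⟨ +-identityʳ _ ⟩
    (n′ G + 2 * nG′ G) * n′ G
      ∎
    where
    open ≡-Reasoning
    g : Fin (2 + m) → Fin (2 + m) → ℕ
    g u v = if universal u then ecc G v else 0
    row : ∀ u → ∑[ v < 2 + m ] (if adj G u v then g u v else 0) + indicator (universal u)
              ≡ (if universal u then ∑[ v < 2 + m ] ecc G v else 0)
    row u with universal u in univ
    ... | true  = trans (cong (∑[ v < 2 + m ] (if adj G u v then ecc G v else 0) +_)
                              (≡.sym (trans (ecc-diameter-two u) (if-cong univ))))
                        (dominating-row G (universal⇒dominating G univ) (ecc G))
    ... | false = trans (+-identityʳ _) (∑-zero _ (λ v → if-eta (adj G u v)))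

  mixed-rows : arcSum G (λ u v → if not (universal u) then (if universal v then 2 else 0) else 0) ≡ 2 * n′ G * nG′ G
  mixed-rows = begin
    ∑[ u < 2 + m ] ∑[ v < 2 + m ] (if adj G u v then g u v else 0)
      ≡⟨ sum-cong-≗ row ⟩
    ∑[ u < 2 + m ] (if universal u then 0 else 2 * count universal)
      ≡⟨ ∑-if universal 0 (2 * count universal) ⟩
    2 * count universal * count (not ∘ universal)
      ≡⟨ cong₂ (λ k w → 2 * k * w) n′≡count nG′≡count ⟨
    2 * n′ G * nG′ G
      ∎
    where
    open ≡-Reasoning
    g : Fin (2 + m) → Fin (2 + m) → ℕ
    g u v = if not (universal u) then (if universal v then 2 else 0) else 0
    row : ∀ u → ∑[ v < 2 + m ] (if adj G u v then g u v else 0) ≡ (if universal u then 0 else 2 * count universal)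
    row u with universal u in univ-u
    ... | true  = ∑-zero _ (λ v → if-eta (adj G u v))
    ... | false = trans (sum-cong-≗ adjacent-if-universal)
                        (trans (∑-if universal 2 0) (+-identityʳ (2 * count universal)))
      where
      adjacent-if-universal : ∀ v → (if adj G u v then (if universal v then 2 else 0) else 0)
                                    ≡ (if universal v then 2 else 0)
      adjacent-if-universal v with universal v in univ-v
      ... | true  = if-true (adjacent-to-universal G univ-v univ-u)
      ... | false = if-eta (adj G u v)

  E₂-doubled : E₂ G + E₂ G + n′ G ≡ n′ G * n′ G + 4 * n′ G * nG′ G + 8 * mG′ G
  E₂-doubled = begin
    E₂ G + E₂ G + n′ G
      ≡⟨ cong (_+ n′ G) (trans E₂+E₂≡arcSum (arcSum-cong G ecc-product)) ⟩
    arcSum G (λ u v → 4 * g₁ u v + (g₂ u v + g₃ u v)) + n′ G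
      ≡⟨ cong (_+ n′ G) (trans (arcSum-+ G (λ u v → 4 * g₁ u v) (λ u v → g₂ u v + g₃ u v))
                               (cong₂ _+_ (arcSum-* G 4 g₁) (arcSum-+ G g₂ g₃))) ⟩
    4 * arcSum G g₁ + (arcSum G g₂ + arcSum G g₃) + n′ G
      ≡⟨ swap-last (4 * arcSum G g₁) (arcSum G g₂) (arcSum G g₃) (n′ G) ⟩
    4 * arcSum G g₁ + (arcSum G g₂ + n′ G) + arcSum G g₃
      ≡⟨ cong₂ _+_ (cong₂ _+_ (cong (4 *_) (≡.sym mG′+mG′≡arcSum)) universal-rows) mixed-rows ⟩
    4 * (mG′ G + mG′ G) + (n′ G + 2 * nG′ G) * n′ G + 2 * n′ G * nG′ G
      ≡⟨ collect (n′ G) (nG′ G) (mG′ G) ⟩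
    n′ G * n′ G + 4 * n′ G * nG′ G + 8 * mG′ G
      ∎
    where
    open ≡-Reasoning
    g₁ g₂ g₃ : Fin (2 + m) → Fin (2 + m) → ℕ
    g₁ u v = indicator (not (universal u) ∧ not (universal v))
    g₂ u v = if universal u then ecc G v else 0
    g₃ u v = if not (universal u) then (if universal v then 2 else 0) else 0
    swap-last : ∀ a b c d → a + (b + c) + d ≡ a + (b + d) + c
    swap-last = solve-∀
    collect : ∀ k w e → 4 * (e + e) + (k + 2 * w) * k + 2 * k * w ≡ k * k + 4 * k * w + 8 * e
    collect = solve-∀

  n′≥1 : ¬ SelfCentered G → 1 ≤ n′ G
  n′≥1 ¬self-centered = n≢0⇒n>0 λ n′≡0 → ¬self-centered (trans diam≡2 (≡.sym (rad≡2 n′≡0)))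
    where
    rad≡2 : n′ G ≡ 0 → rad G ≡ 2
    rad≡2 n′≡0 = trans (cong (λ d → foldr _⊓_ d (map (ecc G) (allFin (2 + m)))) diam≡2)
      (foldr-⊓-map-tabulate-const id (ecc G) λ v →
        trans (ecc-diameter-two v) (if-cong (count≡0⇒false universal (trans (≡.sym n′≡count) n′≡0) v)))

  nG′≥1 : 1 ≤ nG′ G
  nG′≥1 = n≢0⇒n>0 λ nG′≡0 → <-irrefl refl (subst (_≤ 1) diam≡2 (diam≤1 nG′≡0))
    where
    diam≤1 : nG′ G ≡ 0 → diam G ≤ 1
    diam≤1 nG′≡0 = foldr-⊔-map-tabulate-lub id (ecc G) λ v →
      ≤-reflexive (trans (ecc-diameter-two v)
        (if-cong (not-injective (count≡0⇒false (not ∘ universal) (trans (≡.sym nG′≡count) nG′≡0) v))))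

double-cancelʳ-< : ∀ a b c → a + a + c < b + b + c → a < b
double-cancelʳ-< a b c lt = ≰⇒> λ b≤a → <⇒≱ (+-cancelʳ-< c (a + a) (b + b) lt) (+-mono-≤ b≤a b≤a)

<-of-gap : ∀ {a b} d → b ≡ suc (a + d) → a < b
<-of-gap {a} d refl = s≤s (m≤m+n a d)

many-universal-< : ∀ k w e → 3 ≤ k → 1 ≤ w → 3 * k + 8 * w < k * k + 4 * k * w + 8 * e
many-universal-< k w e k≥3 w≥1 = begin-strict
  3 * k + 8 * w               <⟨ +-monoʳ-< (3 * k) (*-monoˡ-< w {{>-nonZero w≥1}} (m≤m+n 9 3)) ⟩
  3 * k + 12 * w              ≤⟨ +-mono-≤ (*-monoˡ-≤ k k≥3) (*-monoˡ-≤ w (*-monoʳ-≤ 4 k≥3)) ⟩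
  k * k + 4 * k * w           ≤⟨ m≤m+n (k * k + 4 * k * w) (8 * e) ⟩
  k * k + 4 * k * w + 8 * e   ∎
  where open ≤-Reasoning

two-universal-< : ∀ w e → 3 * 2 + 8 * w < 2 * 2 + 4 * 2 * w + 8 * suc e
two-universal-< w e = <-of-gap (5 + 8 * e) (gap w e)
  where
  gap : ∀ w e → 4 + 8 * w + 8 * suc e ≡ suc (6 + 8 * w + (5 + 8 * e))
  gap = solve-∀

two-universal-> : ∀ w → 2 * 2 + 4 * 2 * w + 8 * 0 < 3 * 2 + 8 * w
two-universal-> w = <-of-gap 1 (gap w)
  where
  gap : ∀ w → 6 + 8 * w ≡ suc (4 + 8 * w + 0 + 1)
  gap = solve-∀

one-universal-< : ∀ w e → 1 + 2 * w < 4 * e → 3 * 1 + 8 * w < 1 * 1 + 4 * 1 * w + 8 * e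
one-universal-< w e lt = begin-strict
  3 + 8 * w                   ≡⟨ split w ⟩
  1 + 4 * w + 2 * (1 + 2 * w) <⟨ +-monoʳ-< (1 + 4 * w) (*-monoʳ-< 2 lt) ⟩
  1 + 4 * w + 2 * (4 * e)     ≡⟨ merge w e ⟩
  1 + 4 * w + 8 * e           ∎
  where
  open ≤-Reasoning
  split : ∀ w → 3 + 8 * w ≡ 1 + 4 * w + 2 * (1 + 2 * w)
  split = solve-∀
  merge : ∀ w e → 1 + 4 * w + 2 * (4 * e) ≡ 1 + 4 * w + 8 * e
  merge = solve-∀

one-universal-> : ∀ w e → ¬ 1 + 2 * w < 4 * e → 1 * 1 + 4 * 1 * w + 8 * e < 3 * 1 + 8 * w
one-universal-> w e ≮ = begin-strict
  1 + 4 * w + 8 * e           ≡⟨ merge w e ⟨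
  1 + 4 * w + 2 * (4 * e)     ≤⟨ +-monoʳ-≤ (1 + 4 * w) (*-monoʳ-≤ 2 4e≤2w) ⟩
  1 + 4 * w + 2 * (2 * w)     <⟨ <-of-gap 1 (gap w) ⟩
  3 + 8 * w                   ∎
  where
  open ≤-Reasoning
  merge : ∀ w e → 1 + 4 * w + 2 * (4 * e) ≡ 1 + 4 * w + 8 * e
  merge = solve-∀
  gap : ∀ w → 3 + 8 * w ≡ suc (1 + 4 * w + 2 * (2 * w) + 1)
  gap = solve-∀
  quadruple : ∀ e → 2 * (2 * e) ≡ 4 * e
  quadruple = solve-∀
  4e≤2w : 4 * e ≤ 2 * w
  4e≤2w = s≤s⁻¹ (≤∧≢⇒< (≮⇒≥ ≮) (even≢odd (2 * e) w ∘ trans (quadruple e)))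

-- The average-degree thresholds

mkℚᵘ<mkℚᵘ⇔ : ∀ a c b d → mkℚᵘ (ℤ.+ a) c ℚᵘ.< mkℚᵘ (ℤ.+ b) d ⇔ a * suc d < b * suc c
mkℚᵘ<mkℚᵘ⇔ a c b d = mk⇔
  (λ p<q → drop‿+<+ (subst₂ ℤ._<_ (≡.sym (pos-* a (suc d))) (≡.sym (pos-* b (suc c))) (drop-*<* p<q)))
  (λ lt → *<* (subst₂ ℤ._<_ (pos-* a (suc d)) (pos-* b (suc c)) (+<+ lt)))

fromℚᵘ<fromℚᵘ⇔ : ∀ p q → fromℚᵘ p ℚ.< fromℚᵘ q ⇔ p ℚᵘ.< q
fromℚᵘ<fromℚᵘ⇔ p q = mk⇔
  (λ lt → <-respʳ-≃ (toℚᵘ-fromℚᵘ q) (<-respˡ-≃ (toℚᵘ-fromℚᵘ p) (toℚᵘ-mono-< lt)))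
  (λ lt → toℚᵘ-cancel-< (<-respʳ-≃ (≃-sym (toℚᵘ-fromℚᵘ q)) (<-respˡ-≃ (≃-sym (toℚᵘ-fromℚᵘ p)) lt)))

+/suc<+/suc⇔ : ∀ a c b d → ℤ.+ a ℚ./ suc c ℚ.< ℤ.+ b ℚ./ suc d ⇔ a * suc d < b * suc c
+/suc<+/suc⇔ a c b d = mkℚᵘ<mkℚᵘ⇔ a c b d ⇔-∘ fromℚᵘ<fromℚᵘ⇔ (mkℚᵘ (ℤ.+ a) c) (mkℚᵘ (ℤ.+ b) d)

threshold≡ : ∀ j → threshold (2 + j) ≡ ℤ.+ suc (2 * suc j) ℚ./ (2 * suc j)
threshold≡ j = toℚᵘ-injective (begin
  toℚᵘ (1ℚ ℚ.+ ℤ.+ 1 ℚ./ (2 * suc j))          ≈⟨ toℚᵘ-homo-+ 1ℚ (ℤ.+ 1 ℚ./ (2 * suc j)) ⟩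
  toℚᵘ 1ℚ ℚᵘ.+ toℚᵘ (ℤ.+ 1 ℚ./ (2 * suc j))     ≈⟨ +-cong (toℚᵘ-fromℚᵘ 1ℚᵘ) (toℚᵘ-fromℚᵘ (mkℚᵘ (ℤ.+ 1) D)) ⟩
  1ℚᵘ ℚᵘ.+ mkℚᵘ (ℤ.+ 1) D                       ≈⟨ *≡* (cong ℤ.+_ (cross-multiplied D)) ⟩
  mkℚᵘ (ℤ.+ suc (2 * suc j)) D                 ≈⟨ toℚᵘ-fromℚᵘ (mkℚᵘ (ℤ.+ suc (2 * suc j)) D) ⟨
  toℚᵘ (ℤ.+ suc (2 * suc j) ℚ./ (2 * suc j))   ∎)
  where
  open ≃-Reasoning
  D = ℕ.pred (2 * suc j)
  -- The normal form of the cross-multiplied numerators of 1 + 1/(D + 1) and (D + 2)/(D + 1).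
  cross-multiplied : ∀ D → 1 + (D + (D + 0 + 1) * (1 + D)) ≡ 1 + (D + 0 + (1 + (D + 0 + D * (1 + (D + 0)))))
  cross-multiplied = solve-∀

0<avdOf⇔ : ∀ m j → 0ℚ ℚ.< avdOf m (suc j) ⇔ 0 < m
0<avdOf⇔ zero    j = mk⇔ (λ lt → contradiction (Equivalence.to (+/suc<+/suc⇔ 0 0 0 j) lt) (<-irrefl refl)) (λ ())
0<avdOf⇔ (suc m) j = mk⇔ (λ _ → z<s) (λ _ → Equivalence.from (+/suc<+/suc⇔ 0 0 (2 * suc m) j) z<s)

threshold<avdOf⇔ : ∀ m j → threshold (2 + j) ℚ.< avdOf m (suc j) ⇔ 1 + 2 * suc j < 4 * m
threshold<avdOf⇔ m j = mk⇔ to from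
  where
  t = suc (2 * suc j)
  avd = avdOf m (suc j)
  fractions : ℤ.+ t ℚ./ (2 * suc j) ℚ.< avd ⇔ t * suc j < 2 * m * (2 * suc j)
  fractions = +/suc<+/suc⇔ t (ℕ.pred (2 * suc j)) (2 * m) j
  double-product : ∀ m s → 2 * m * (2 * s) ≡ 4 * m * s
  double-product = solve-∀
  to : threshold (2 + j) ℚ.< avd → t < 4 * m
  to lt = *-cancelʳ-< (suc j) t (4 * m)
    (subst (t * suc j <_) (double-product m (suc j)) (Equivalence.to fractions (subst (ℚ._< avd) (threshold≡ j) lt)))
  from : t < 4 * m → threshold (2 + j) ℚ.< avd
  from lt = subst (ℚ._< avd) (≡.sym (threshold≡ j))
    (Equivalence.from fractions (subst (t * suc j <_) (≡.sym (double-product m (suc j))) (*-monoˡ-< (suc j) lt)))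

-- Conditions (i)–(iii) for n = n(G), k = n′(G), w = n(G′) and e = m(G′).
E₁<E₂-Criterion : ℕ → ℕ → ℕ → ℕ → Set
E₁<E₂-Criterion n k w e = k ≥ 3 ⊎ (k ≡ 2 × 0ℚ ℚ.< avdOf e w) ⊎ (k ≡ 1 × threshold n ℚ.< avdOf e w)

doubled-E₁-vs-E₂ : ∀ {n} k w e → n ≡ k + w → 1 ≤ k → 1 ≤ w →
  (E₁<E₂-Criterion n k w e → 3 * k + 8 * w < k * k + 4 * k * w + 8 * e) ×
  (¬ E₁<E₂-Criterion n k w e → k * k + 4 * k * w + 8 * e < 3 * k + 8 * w)
doubled-E₁-vs-E₂ 1 (suc j) e refl _ _ = criterion⇒ , ¬criterion⇒
  where
  criterion⇒ : E₁<E₂-Criterion (2 + j) 1 (suc j) e → 3 * 1 + 8 * suc j < 1 * 1 + 4 * 1 * suc j + 8 * e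
  criterion⇒ (inj₁ (s≤s ()))
  criterion⇒ (inj₂ (inj₁ (() , _)))
  criterion⇒ (inj₂ (inj₂ (refl , t<avd))) = one-universal-< (suc j) e (Equivalence.to (threshold<avdOf⇔ e j) t<avd)
  ¬criterion⇒ : ¬ E₁<E₂-Criterion (2 + j) 1 (suc j) e → 1 * 1 + 4 * 1 * suc j + 8 * e < 3 * 1 + 8 * suc j
  ¬criterion⇒ ¬c = one-universal-> (suc j) e
    λ lt → ¬c (inj₂ (inj₂ (refl , Equivalence.from (threshold<avdOf⇔ e j) lt)))
doubled-E₁-vs-E₂ 2 (suc j) zero refl _ _ = criterion⇒ , λ _ → two-universal-> (suc j)
  where
  criterion⇒ : E₁<E₂-Criterion (3 + j) 2 (suc j) 0 → 3 * 2 + 8 * suc j < 2 * 2 + 4 * 2 * suc j + 8 * 0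
  criterion⇒ (inj₁ (s≤s (s≤s ())))
  criterion⇒ (inj₂ (inj₁ (refl , 0<avd))) = contradiction (Equivalence.to (0<avdOf⇔ 0 j) 0<avd) λ ()
  criterion⇒ (inj₂ (inj₂ (() , _)))
doubled-E₁-vs-E₂ 2 (suc j) (suc e) refl _ _ =
  (λ _ → two-universal-< (suc j) e) ,
  (λ ¬c → contradiction (inj₂ (inj₁ (refl , Equivalence.from (0<avdOf⇔ (suc e) j) z<s))) ¬c)
doubled-E₁-vs-E₂ k@(suc (suc (suc _))) w e _ _ w≥1 =
  (λ _ → many-universal-< k w e (s≤s (s≤s (s≤s z≤n))) w≥1) ,
  (λ ¬c → contradiction (inj₁ (s≤s (s≤s (s≤s z≤n)))) ¬c)

theorem2p3 : (n : ℕ) (G : Graph n) → n ≥ 3 → Connected G → diam G ≡ 2 → ¬ SelfCentered G →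
    ((n′ G ≥ 3 ⊎ (n′ G ≡ 2 × 0ℚ Data.Rational.< avdG′ G) ⊎ (n′ G ≡ 1 × threshold n Data.Rational.< avdG′ G)) → E₁ G < E₂ G)
    × (¬ (n′ G ≥ 3 ⊎ (n′ G ≡ 2 × 0ℚ Data.Rational.< avdG′ G) ⊎ (n′ G ≡ 1 × threshold n Data.Rational.< avdG′ G)) → E₁ G > E₂ G)
theorem2p3 (suc (suc m)) G _ _ diam≡2 ¬self-centered =
    (λ c  → double-cancelʳ-< (E₁ G) (E₂ G) k (subst₂ _<_ 2E₁+k 2E₂+k (proj₁ signs c)))
  , (λ ¬c → double-cancelʳ-< (E₂ G) (E₁ G) k (subst₂ _<_ 2E₂+k 2E₁+k (proj₂ signs ¬c)))
  where
  k = n′ G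
  w = nG′ G
  signs = doubled-E₁-vs-E₂ k w (mG′ G) (≡.sym (n′+nG′ G diam≡2))
                          (n′≥1 G diam≡2 ¬self-centered) (nG′≥1 G diam≡2)
  2E₂+k : k * k + 4 * k * w + 8 * mG′ G ≡ E₂ G + E₂ G + k
  2E₂+k = ≡.sym (E₂-doubled G diam≡2)
  2E₁+k : 3 * k + 8 * w ≡ E₁ G + E₁ G + k
  2E₁+k = ≡.sym (trans (cong (λ x → x + x + k) (E₁≡n′+4nG′ G diam≡2)) (collect k w))
    where
    collect : ∀ k w → k + 4 * w + (k + 4 * w) + k ≡ 3 * k + 8 * w
    collect = solve-∀
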